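{- Let $G$ be a finite simple connected claw-free graph, and let $v$ be a vertex of $G$ of largest degree $\Delta$, with neighbourhood $N(v)$. Then: (a) for every $u\in N(v)$ there is a path $P_u$ in $G$ starting at $u$ which covers all vertices of $N(v)\cup\{v\}$; (b) $t(G)\geq \Delta+1$, and if $V(G)\neq N(v)\cup\{v\}$ then $t(G)\geq \Delta+2$.
   Context: A graph is claw-free if it has no induced subgraph isomorphic to $K_{1,3}$. For a graph $G$, $t(G)$ denotes the number of vertices of a longest path in $G$. -}

module Defs where

open import Data.Nat using (ℕ; suc; _≤_)
open import Data.Bool using (Bool; true; false)
open import Data.Fin using (Fin)
open import Data.List using (List; []; _∷_; length; filter; allFin; last)
open import Data.Maybe using (just)
open import Data.List.Relation.Unary.Unique.Propositional using (Unique)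
open import Data.List.Membership.Propositional using (_∈_)
open import Data.Product using (Σ; ∃; _×_; _,_)
open import Data.Sum using (_⊎_)
open import Relation.Binary.PropositionalEquality using (_≡_; _≢_)
open import Relation.Nullary using (¬_)
open import Data.Bool using (_≟_)

record Graph (n : ℕ) : Set where
  field
    adj     : Fin n → Fin n → Bool
    adj-sym : ∀ x y → adj x y ≡ adj y x
    adj-irr : ∀ x → adj x x ≡ false
open Graph public

module _ {n : ℕ} (G : Graph n) where

  Adj : Fin n → Fin n → Set
  Adj x y = adj G x y ≡ true

  neighbours : Fin n → List (Fin n)
  neighbours x = filter (λ y → adj G x y ≟ true) (allFin n)

  degree : Fin n → ℕ
  degree x = length (neighbours x)

  data IsWalk : List (Fin n) → Set where
    walk-[]  : IsWalk []
    walk-[_] : ∀ x → IsWalk (x ∷ [])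
    walk-∷   : ∀ {x y} {xs} → Adj x y → IsWalk (y ∷ xs) → IsWalk (x ∷ y ∷ xs)

  -- a path: a nonempty walk with pairwise distinct vertices;
  -- the number of vertices of a path P is  length P
  IsPath : List (Fin n) → Set
  IsPath P = IsWalk P × Unique P

  Connected : Set
  Connected = ∀ x y → ∃ λ rest → IsPath (x ∷ rest) × last (x ∷ rest) ≡ just y

  ClawFree : Set
  ClawFree = ∀ c a b d → Adj c a → Adj c b → Adj c d →
             a ≢ b → a ≢ d → b ≢ d →
             ¬ (adj G a b ≡ false × adj G a d ≡ false × adj G b d ≡ false)

  MaxDegreeVertex : Fin n → Set
  MaxDegreeVertex v = ∀ w → degree w ≤ degree v

  IsLongestPathOrder : ℕ → Set
  IsLongestPathOrder t = (∃ λ P → IsPath P × length P ≡ t)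
                       × (∀ P → IsPath P → length P ≤ t)

module Submission where

-- Let v be a vertex of a claw-free graph G and N[v] = {v} ∪ N(v) its closed
-- neighbourhood.  The key fact (part (a)) is that for every neighbour u of v
-- there is a path starting at u whose vertex set is exactly N[v].  It is built
-- by threading the neighbours one at a time into a path of the shape
--     A ++ v ∷ B ,   A a walk from u to a,  B empty or a walk starting at b,
-- with A and B disjoint lists of neighbours of v.  A new neighbour x is
-- appended to A if a ~ x, prepended to B if x ~ b, and otherwise claw-freeness
-- at v (applied to a, b, x) forces a ~ b, so that A ++ B becomes the new left
-- part and [x] the new right part.
-- Part (b) follows by counting: a path containing N[v] has at least deg v + 1
-- vertices, and if some vertex lies outside N[v], connectivity gives an edge
-- from a neighbour x of v to a vertex y ∉ N[v], and y followed by the path of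
-- part (a) from x has at least deg v + 2 vertices.

open import Defs
open import Data.Nat using (ℕ; suc; _≤_; z≤n; s≤s)
open import Data.Nat.Properties using (≤-trans)
open import Data.Bool using (true; false)
import Data.Bool as Bool
open import Data.Fin using (Fin)
import Data.Fin as Fin
open import Data.List using (List; []; _∷_; _++_; length; allFin; last; removeAt)
open import Data.List.Properties using (length-removeAt′)
open import Data.Maybe using (just)
open import Data.Maybe.Properties using (just-injective)
open import Data.List.Membership.Propositional using (_∈_; _∉_)
open import Data.List.Membership.Propositional.Properties
  using (∈-++⁺ˡ; ∈-++⁺ʳ; ∈-++⁻; ∈-filter⁺; ∈-allFin)
open import Data.List.Relation.Unary.Any as Any using (here; there)
open import Data.List.Relation.Unary.All as All using (All; []; _∷_)
open import Data.List.Relation.Unary.All.Properties using (all-filter; ¬Any⇒All¬; ++⁺)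
open import Data.List.Relation.Unary.AllPairs using ([]; _∷_)
open import Data.List.Relation.Unary.Unique.Propositional using (Unique)
import Data.List.Relation.Unary.Unique.Propositional.Properties as Unique
open import Data.List.Relation.Binary.Disjoint.Propositional using (Disjoint)
open import Data.Product using (∃; ∃₂; _×_; _,_; proj₁; proj₂)
open import Data.Sum using (_⊎_; inj₁; inj₂)
open import Data.Empty using (⊥-elim)
open import Relation.Nullary using (¬_; yes; no)
open import Relation.Nullary.Decidable using (_⊎-dec_)
open import Relation.Unary using (Decidable)
open import Relation.Binary.PropositionalEquality using (_≡_; _≢_; refl; sym; trans; subst)

∉-++ : ∀ {X : Set} {x : X} {A B} → x ∉ A → x ∉ B → x ∉ A ++ B
∉-++ {A = A} x∉A x∉B x∈ with ∈-++⁻ A x∈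
... | inj₁ x∈A = x∉A x∈A
... | inj₂ x∈B = x∉B x∈B

#-singleton : ∀ {X : Set} {x : X} {A} → x ∉ A → Disjoint A (x ∷ [])
#-singleton x∉A (x∈A , here refl) = x∉A x∈A

∈-removeAt : ∀ {A : Set} {x z : A} {ys} (p : x ∈ ys) →
             z ∈ ys → z ≢ x → z ∈ removeAt ys (Any.index p)
∈-removeAt (here refl) (here refl) z≢x = ⊥-elim (z≢x refl)
∈-removeAt (here refl) (there z∈ys) _  = z∈ys
∈-removeAt (there p)   (here refl)  _  = here refl
∈-removeAt (there p)   (there z∈ys) z≢x = there (∈-removeAt p z∈ys z≢x)

-- A duplicate-free list contained in ys is at most as long as ys; this is how
-- the lengths of paths are bounded from below.
unique⊆⇒length≤ : ∀ {A : Set} {xs ys : List A} →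
                  Unique xs → (∀ {z} → z ∈ xs → z ∈ ys) → length xs ≤ length ys
unique⊆⇒length≤ [] _ = z≤n
unique⊆⇒length≤ {xs = x ∷ xs} {ys} (x∉xs ∷ xs-unique) xs⊆ys =
  subst (suc (length xs) ≤_) (sym (length-removeAt′ ys (Any.index x∈ys)))
    (s≤s (unique⊆⇒length≤ xs-unique λ z∈xs →
      ∈-removeAt x∈ys (xs⊆ys (there z∈xs)) λ z≡x → All.lookup x∉xs z∈xs (sym z≡x)))
  where
  x∈ys : x ∈ ys
  x∈ys = xs⊆ys (here refl)

module _ {n : ℕ} (G : Graph n) where

  Adj-sym : ∀ {x y} → Adj G x y → Adj G y x
  Adj-sym {x} {y} x~y = trans (adj-sym G y x) x~y

  Adj-irrefl : ∀ {x} → ¬ Adj G x x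
  Adj-irrefl {x} x~x with trans (sym x~x) (adj-irr G x)
  ... | ()

  false⇒¬Adj : ∀ {x y} → adj G x y ≡ false → ¬ Adj G x y
  false⇒¬Adj x≁y x~y with trans (sym x~y) x≁y
  ... | ()

  claw-edge : ClawFree G → ∀ {c a b x} → Adj G c a → Adj G c b → Adj G c x →
              a ≢ b → a ≢ x → b ≢ x → adj G a x ≡ false → adj G x b ≡ false →
              Adj G a b
  claw-edge claw-free {c} {a} {b} {x} c~a c~b c~x a≢b a≢x b≢x a≁x x≁b
    with adj G a b in a~b
  ... | true  = refl
  ... | false = ⊥-elim (claw-free c a b x c~a c~b c~x a≢b a≢x b≢x
                          (a~b , a≁x , trans (adj-sym G b x) x≁b))

  data Walk : Fin n → Fin n → List (Fin n) → Set where
    stop : ∀ x → Walk x x (x ∷ [])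
    _▸_  : ∀ {x y z xs} → Adj G x y → Walk y z xs → Walk x z (x ∷ xs)

  infixr 5 _▸_

  join : ∀ {a b c d xs ys} → Walk a b xs → Adj G b c → Walk c d ys → Walk a d (xs ++ ys)
  join (stop _)   b~c w = b~c ▸ w
  join (e ▸ w′)   b~c w = e ▸ join w′ b~c w

  Walk⇒IsWalk : ∀ {a b xs} → Walk a b xs → IsWalk G xs
  Walk⇒IsWalk (stop x)        = walk-[ x ]
  Walk⇒IsWalk (e ▸ stop y)    = walk-∷ e walk-[ y ]
  Walk⇒IsWalk (e ▸ w@(_ ▸ _)) = walk-∷ e (Walk⇒IsWalk w)

  source≡head : ∀ {a b xs} → Walk a b xs → ∃ λ rest → xs ≡ a ∷ rest
  source≡head (stop _)        = [] , refl
  source≡head (_▸_ {xs = xs} _ _) = xs , refl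

  source∈ : ∀ {a b xs} → Walk a b xs → a ∈ xs
  source∈ w with source≡head w
  ... | _ , refl = here refl

  target∈ : ∀ {a b xs} → Walk a b xs → b ∈ xs
  target∈ (stop _) = here refl
  target∈ (_ ▸ w)  = there (target∈ w)

  exit-edge : {S : Fin n → Set} → Decidable S → ∀ {w} x xs →
              IsWalk G (x ∷ xs) → last (x ∷ xs) ≡ just w → S x → ¬ S w →
              ∃₂ λ y z → Adj G y z × S y × ¬ S z
  exit-edge {S} S? x [] _ ends-w Sx ¬Sw =
    ⊥-elim (¬Sw (subst S (just-injective ends-w) Sx))
  exit-edge S? x (y ∷ ys) (walk-∷ x~y walk) ends-w Sx ¬Sw with S? y
  ... | yes Sy  = exit-edge S? y ys walk ends-w Sy ¬Sw
  ... | no  ¬Sy = x , y , x~y , Sx , ¬Sy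

module ClosedNeighbourhood {n : ℕ} (G : Graph n) (v : Fin n) where

  N[v] : Fin n → Set
  N[v] w = w ≡ v ⊎ Adj G v w

  N[v]? : Decidable N[v]
  N[v]? w = (w Fin.≟ v) ⊎-dec (adj G v w Bool.≟ true)

  nbrs : List (Fin n)
  nbrs = neighbours G v

  nbrs-adjacent : All (Adj G v) nbrs
  nbrs-adjacent = all-filter (λ y → adj G v y Bool.≟ true) (allFin n)

  adjacent⇒∈nbrs : ∀ {w} → Adj G v w → w ∈ nbrs
  adjacent⇒∈nbrs {w} v~w = ∈-filter⁺ (λ y → adj G v y Bool.≟ true) (∈-allFin w) v~w

  v∉ : ∀ {xs} → All (Adj G v) xs → v ∉ xs
  v∉ v~xs v∈xs = Adj-irrefl G (All.lookup v~xs v∈xs)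

  N[v]-unique : Unique (v ∷ nbrs)
  N[v]-unique = ¬Any⇒All¬ nbrs (v∉ nbrs-adjacent)
              ∷ Unique.filter⁺ (λ y → adj G v y Bool.≟ true) (Unique.allFin⁺ n)

  ∈N[v] : ∀ {w} → w ∈ v ∷ nbrs → N[v] w
  ∈N[v] (here refl) = inj₁ refl
  ∈N[v] (there w∈)  = inj₂ (All.lookup nbrs-adjacent w∈)

  non-neighbour∉N[v] : ∀ {w} → w ≢ v → adj G v w ≡ false → ¬ N[v] w
  non-neighbour∉N[v] w≢v _   (inj₁ w≡v) = w≢v w≡v
  non-neighbour∉N[v] _   v≁w (inj₂ v~w) = false⇒¬Adj G v≁w v~w

  Covers : List (Fin n) → Set
  Covers L = ∀ w → N[v] w → w ∈ L

  covering⇒degree< : ∀ {L} → Covers L → suc (degree G v) ≤ length L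
  covering⇒degree< cover = unique⊆⇒length≤ N[v]-unique λ w∈ → cover _ (∈N[v] w∈)

  covering⇒degree+1< : ∀ {y L} → ¬ N[v] y → Covers L →
                       suc (suc (degree G v)) ≤ length (y ∷ L)
  covering⇒degree+1< {y} {L} y∉N cover =
    unique⊆⇒length≤ (¬Any⇒All¬ _ (λ y∈ → y∉N (∈N[v] y∈)) ∷ N[v]-unique) ⊆y∷L
    where
    ⊆y∷L : ∀ {z} → z ∈ y ∷ v ∷ nbrs → z ∈ y ∷ L
    ⊆y∷L (here refl) = here refl
    ⊆y∷L (there z∈)  = there (cover _ (∈N[v] z∈))

  record SpanningPath (u : Fin n) : Set where
    field
      rest   : List (Fin n)
      path   : IsPath G (u ∷ rest)
      covers : Covers (u ∷ rest)
      inside : All N[v] (u ∷ rest)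

  leaving-edge : Connected G → ∀ {w} → ¬ N[v] w →
                 ∃₂ λ x y → Adj G v x × Adj G x y × ¬ N[v] y
  leaving-edge connected {w} w∉N with connected v w
  ... | rest , (walk , _) , ends-w
    with exit-edge G N[v]? v rest walk ends-w (inj₁ refl) w∉N
  ... | x , y , x~y , inj₂ v~x , y∉N = x , y , v~x , x~y , y∉N
  ... | x , y , x~y , inj₁ refl , y∉N = ⊥-elim (y∉N (inj₂ x~y))

-- Part (a): threading N(v) into a path through v, in a claw-free graph.
module Threading {n : ℕ} (G : Graph n) (claw-free : ClawFree G) (v : Fin n) where
  open ClosedNeighbourhood G v
  open import Data.List.Membership.DecPropositional (Fin._≟_ {n}) using (_∈?_)

  data RightPart : List (Fin n) → Set where
    empty : RightPart []
    walk  : ∀ {b c B} → Walk G b c B → RightPart B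

  -- The invariant of the construction: A ++ v ∷ B is a path from u.
  record Split (u : Fin n) (A B : List (Fin n)) : Set where
    field
      a        : Fin n
      left     : Walk G u a A
      right    : RightPart B
      A⊆N      : All (Adj G v) A
      B⊆N      : All (Adj G v) B
      A-unique : Unique A
      B-unique : Unique B
      A#B      : Disjoint A B
  open Split

  Covered : List (Fin n) → List (Fin n) → Fin n → Set
  Covered A B y = y ∈ A ⊎ y ∈ B

  Extension : Fin n → List (Fin n) → List (Fin n) → Fin n → Set
  Extension u A B x = ∃₂ λ A′ B′ → Split u A′ B′ × Covered A′ B′ x ×
                                    (∀ {y} → Covered A B y → Covered A′ B′ y)

  start-right : ∀ {u A x} → Split u A [] → Adj G v x → x ∉ A → Split u A (x ∷ [])
  start-right s v~x x∉A = record
    { a = a s ; left = left s ; right = walk (stop _)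
    ; A⊆N = A⊆N s ; B⊆N = v~x ∷ []
    ; A-unique = A-unique s ; B-unique = [] ∷ []
    ; A#B = #-singleton x∉A }

  extend-left : ∀ {u A B x} (s : Split u A B) → Adj G (a s) x → Adj G v x →
                x ∉ A → x ∉ B → Split u (A ++ x ∷ []) B
  extend-left {A = A} {B} {x} s a~x v~x x∉A x∉B = record
    { a = _ ; left = join G (left s) a~x (stop _) ; right = right s
    ; A⊆N = ++⁺ (A⊆N s) (v~x ∷ []) ; B⊆N = B⊆N s
    ; A-unique = Unique.++⁺ (A-unique s) ([] ∷ []) (#-singleton x∉A) ; B-unique = B-unique s
    ; A#B = A#B′ }
    where
    A#B′ : Disjoint (A ++ x ∷ []) B
    A#B′ (y∈ , y∈B) with ∈-++⁻ A y∈
    ... | inj₁ y∈A       = A#B s (y∈A , y∈B)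
    ... | inj₂ (here refl) = x∉B y∈B

  extend-right : ∀ {u A B b c x} → Split u A B → Walk G b c B → Adj G x b →
                 Adj G v x → x ∉ A → x ∉ B → Split u A (x ∷ B)
  extend-right {A = A} {B} {x = x} s w x~b v~x x∉A x∉B = record
    { a = a s ; left = left s ; right = walk (x~b ▸ w)
    ; A⊆N = A⊆N s ; B⊆N = v~x ∷ B⊆N s
    ; A-unique = A-unique s ; B-unique = ¬Any⇒All¬ B x∉B ∷ B-unique s
    ; A#B = A#B′ }
    where
    A#B′ : Disjoint A (x ∷ B)
    A#B′ (y∈A , here refl)  = x∉A y∈A
    A#B′ (y∈A , there y∈B) = A#B s (y∈A , y∈B)

  merge : ∀ {u A B b c x} (s : Split u A B) → Walk G b c B → Adj G (a s) b →
          Adj G v x → x ∉ A → x ∉ B → Split u (A ++ B) (x ∷ [])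
  merge s w a~b v~x x∉A x∉B = record
    { a = _ ; left = join G (left s) a~b w ; right = walk (stop _)
    ; A⊆N = ++⁺ (A⊆N s) (B⊆N s) ; B⊆N = v~x ∷ []
    ; A-unique = Unique.++⁺ (A-unique s) (B-unique s) (A#B s) ; B-unique = [] ∷ []
    ; A#B = #-singleton (∉-++ x∉A x∉B) }

  extend : ∀ {u A B x} → Split u A B → Adj G v x → x ∉ A → x ∉ B → Extension u A B x
  extend {A = A} s v~x x∉A x∉B with right s
  ... | empty = _ , _ , start-right s v~x x∉A , inj₂ (here refl)
              , λ { (inj₁ y∈A) → inj₁ y∈A ; (inj₂ ()) }
  ... | walk {b} {c} w with adj G (a s) _ in a~x | adj G _ b in x~b
  ...   | true  | _    = _ , _ , extend-left s a~x v~x x∉A x∉B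
                       , inj₁ (∈-++⁺ʳ A (here refl))
                       , λ { (inj₁ y∈A) → inj₁ (∈-++⁺ˡ y∈A) ; (inj₂ y∈B) → inj₂ y∈B }
  ...   | false | true = _ , _ , extend-right s w x~b v~x x∉A x∉B , inj₂ (here refl)
                       , λ { (inj₁ y∈A) → inj₁ y∈A ; (inj₂ y∈B) → inj₂ (there y∈B) }
  ...   | false | false = _ , _ , merge s w a~b v~x x∉A x∉B , inj₂ (here refl)
                        , λ { (inj₁ y∈A) → inj₁ (∈-++⁺ˡ y∈A) ; (inj₂ y∈B) → inj₁ (∈-++⁺ʳ A y∈B) }
    where
    a∈A : a s ∈ A
    a∈A = target∈ G (left s)
    b∈B : b ∈ _
    b∈B = source∈ G w
    a~b : Adj G (a s) b
    a~b = claw-edge G claw-free (All.lookup (A⊆N s) a∈A) (All.lookup (B⊆N s) b∈B) v~x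
            (λ { refl → A#B s (a∈A , b∈B) })
            (λ { refl → x∉A a∈A })
            (λ { refl → x∉B b∈B })
            a~x x~b

  thread : ∀ {u} → Adj G v u → ∀ xs → All (Adj G v) xs →
           ∃₂ λ A B → Split u A B × All (Covered A B) xs
  thread {u} v~u [] [] = u ∷ [] , [] , initial , []
    where
    initial : Split u (u ∷ []) []
    initial = record { a = u ; left = stop u ; right = empty ; A⊆N = v~u ∷ [] ; B⊆N = []
                     ; A-unique = [] ∷ [] ; B-unique = [] ; A#B = λ { (_ , ()) } }
  thread v~u (x ∷ xs) (v~x ∷ v~xs) with thread v~u xs v~xs
  ... | A , B , s , covered with x ∈? A | x ∈? B
  ...   | yes x∈A | _       = A , B , s , inj₁ x∈A ∷ covered
  ...   | no  _   | yes x∈B = A , B , s , inj₂ x∈B ∷ covered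
  ...   | no  x∉A | no  x∉B with extend s v~x x∉A x∉B
  ...     | A′ , B′ , s′ , x-covered , keeps = A′ , B′ , s′ , x-covered ∷ All.map keeps covered

  split⇒spanning : ∀ {u A B} → Split u A B → (∀ {y} → y ∈ nbrs → Covered A B y) →
                   SpanningPath u
  split⇒spanning {A = A} {B} s covered with source≡head G (left s)
  ... | rest , refl = record
    { rest   = rest ++ v ∷ B
    ; path   = Walk⇒IsWalk G (join G (left s) (Adj-sym G a-adjacent) (proj₂ through-v))
             , Unique.++⁺ (A-unique s) (¬Any⇒All¬ B (v∉ (B⊆N s)) ∷ B-unique s) A#vB
    ; covers = covers
    ; inside = ++⁺ (All.map inj₂ (A⊆N s)) (inj₁ refl ∷ All.map inj₂ (B⊆N s)) }
    where
    a-adjacent : Adj G v (a s)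
    a-adjacent = All.lookup (A⊆N s) (target∈ G (left s))
    through-v : ∃ λ z → Walk G v z (v ∷ B)
    through-v with right s
    ... | empty  = _ , stop v
    ... | walk w = _ , All.lookup (B⊆N s) (source∈ G w) ▸ w
    A#vB : Disjoint A (v ∷ B)
    A#vB (v∈A , here refl) = v∉ (A⊆N s) v∈A
    A#vB (y∈A , there y∈B) = A#B s (y∈A , y∈B)
    covers : Covers (A ++ v ∷ B)
    covers _ (inj₁ refl) = ∈-++⁺ʳ A (here refl)
    covers _ (inj₂ v~w) with covered (adjacent⇒∈nbrs v~w)
    ... | inj₁ w∈A = ∈-++⁺ˡ w∈A
    ... | inj₂ w∈B = ∈-++⁺ʳ A (there w∈B)

  spanning-path : ∀ {u} → Adj G v u → SpanningPath u
  spanning-path v~u with thread v~u nbrs nbrs-adjacent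
  ... | _ , _ , s , covered = split⇒spanning s (All.lookup covered)

-- Part (b): lower bounds on the order of a longest path.
module LongPaths {n : ℕ} (G : Graph n) (claw-free : ClawFree G) (v : Fin n) where
  open ClosedNeighbourhood G v
  open Threading G claw-free v

  covering-path : ∃ λ P → IsPath G P × Covers P
  covering-path with nbrs in nbrs≡
  ... | [] = v ∷ [] , (walk-[ v ] , [] ∷ []) , only-v
    where
    only-v : Covers (v ∷ [])
    only-v _ (inj₁ refl) = here refl
    only-v w (inj₂ v~w) with subst (w ∈_) nbrs≡ (adjacent⇒∈nbrs v~w)
    ... | ()
  ... | x ∷ _ = _ , path , covers
    where open SpanningPath (spanning-path
                (All.lookup nbrs-adjacent (subst (x ∈_) (sym nbrs≡) (here refl))))

  longest-path-bounds : Connected G → ∀ t → IsLongestPathOrder G t →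
    (suc (degree G v) ≤ t)
    × ((∃ λ w → w ≢ v × adj G v w ≡ false) → suc (suc (degree G v)) ≤ t)
  longest-path-bounds connected t (_ , longest) = at-least-Δ+1 , at-least-Δ+2
    where
    at-least-Δ+1 : suc (degree G v) ≤ t
    at-least-Δ+1 with covering-path
    ... | P , P-path , covers = ≤-trans (covering⇒degree< covers) (longest P P-path)
    at-least-Δ+2 : (∃ λ w → w ≢ v × adj G v w ≡ false) → suc (suc (degree G v)) ≤ t
    at-least-Δ+2 (w , w≢v , v≁w)
      with leaving-edge connected (non-neighbour∉N[v] w≢v v≁w)
    ... | x , y , v~x , x~y , y∉N =
      ≤-trans (covering⇒degree+1< y∉N covers)
              (longest (y ∷ x ∷ rest) (walk-∷ (Adj-sym G x~y) (proj₁ path) , y∉P ∷ proj₂ path))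
      where
      open SpanningPath (spanning-path v~x)
      y∉P : All (y ≢_) (x ∷ rest)
      y∉P = ¬Any⇒All¬ _ λ y∈ → y∉N (All.lookup inside y∈)

lemma5p5 : ∀ {n} (G : Graph n) → Connected G → ClawFree G →
           ∀ v → MaxDegreeVertex G v →
           ((∀ u → Adj G v u →
               ∃ λ rest → IsPath G (u ∷ rest) ×
                 (∀ w → (w ≡ v ⊎ Adj G v w) → w ∈ u ∷ rest))
           × (∀ t → IsLongestPathOrder G t →
                (suc (degree G v) ≤ t)
                × ((∃ λ w → w ≢ v × adj G v w ≡ false) → suc (suc (degree G v)) ≤ t)))
lemma5p5 G connected claw-free v _ = part-a , LongPaths.longest-path-bounds G claw-free v connected
  where
  open Threading G claw-free v using (spanning-path)
  part-a : ∀ u → Adj G v u → ∃ λ rest → IsPath G (u ∷ rest) × (∀ w → (w ≡ v ⊎ Adj G v w) → w ∈ u ∷ rest)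
  part-a u v~u = rest , path , covers
    where open ClosedNeighbourhood.SpanningPath (spanning-path v~u)
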